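{- Let $G$ be a graph, and let $G_1,G_2$ be vertex-disjoint subgraphs of $G$ with vertices $v_1\in V(G_1)$, $v_2\in V(G_2)$, such that $G=G_1\cup G_2+v_1v_2$ (i.e. $G$ is the union of $G_1$ and $G_2$ together with the single edge $v_1v_2$). Let $L$ be a list assignment for $G$. Then there exists a list assignment $L'$ for $G$ such that $|L'(v)|=|L(v)|$ for every vertex $v$, $L'(v_1)\subseteq L'(v_2)$ or $L'(v_2)\subseteq L'(v_1)$, and $\mathrm{col}(G,L')\le\mathrm{col}(G,L)$. Moreover, the inequality is strict provided there exist colors $c_1\in L(v_1)\setminus L(v_2)$ and $c_2\in L(v_2)\setminus L(v_1)$ with $\mathrm{col}(G_1,L,v_1,c_1)\neq0$ and $\mathrm{col}(G_2,L,v_2,c_2)\neq 0$.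
   Context: All graphs are finite and simple. A list assignment for a graph $G$ is a function $L$ assigning to each vertex $v$ a finite set $L(v)\subseteq\mathbb{N}$ of colors. A (proper) coloring of $G$ from $L$ is a map $\gamma$ on $V(G)$ with $\gamma(v)\in L(v)$ for all $v$ and $\gamma(v)\neq\gamma(w)$ for adjacent $v,w$. $\mathrm{col}(G,L)$ is the number of colorings of $G$ from $L$. For a subgraph $H$ of $G$, $L$ restricts to a list assignment of $H$ and $\mathrm{col}(H,L)$ denotes the number of colorings of $H$ from this restriction. For a vertex $v$ and $c\in L(v)$, $\mathrm{col}(H,L,v,c)$ denotes the number of colorings of $H$ from $L$ that assign color $c$ to $v$. -}

module Defs where

open import Data.Bool using (Bool; true; false; _∧_; _∨_; not)
open import Data.Nat using (ℕ; zero; suc; _+_; _≡ᵇ_)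
open import Data.Fin using (Fin; zero; suc; splitAt; _↑ˡ_; _↑ʳ_)
open import Data.Fin.Properties using () renaming (_≟_ to _≟F_)
open import Data.Sum using (_⊎_; inj₁; inj₂)
open import Data.List using (List; []; _∷_; [_]; map; concatMap; filterᵇ; length; allFin)
open import Data.Bool.ListAction using (all)
open import Data.List.Relation.Unary.Unique.Propositional using (Unique)
open import Data.Vec using (Vec; []; _∷_; lookup)
open import Relation.Binary.PropositionalEquality using (_≡_)
open import Relation.Nullary.Decidable using (⌊_⌋)

Graph : ℕ → Set
Graph n = Fin n → Fin n → Bool

IsSimple : ∀ {n} → Graph n → Set
IsSimple {n} G = (∀ (i j : Fin n) → G i j ≡ G j i) × (∀ (i : Fin n) → G i i ≡ false)
  where open import Data.Product using (_×_)

-- A list assignment: each vertex gets a finite set of colours, represented by a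
-- duplicate-free list of naturals (so |L(v)| = length (L v)).
ListAssignment : ℕ → Set
ListAssignment n = Fin n → List ℕ

IsListAssignment : ∀ {n} → ListAssignment n → Set
IsListAssignment {n} L = ∀ (v : Fin n) → Unique (L v)

-- All maps γ with γ(v) ∈ L(v) for every v (as vectors), without repetitions
-- when the lists are duplicate-free.
choices : ∀ {n} → ListAssignment n → List (Vec ℕ n)
choices {zero}  L = [ [] ]
choices {suc n} L = concatMap (λ c → map (c ∷_) (choices (λ v → L (suc v)))) (L zero)

properᵇ : ∀ {n} → Graph n → Vec ℕ n → Bool
properᵇ {n} G γ =
  all (λ i → all (λ j → not (G i j) ∨ not (lookup γ i ≡ᵇ lookup γ j)) (allFin n)) (allFin n)

col : ∀ {n} → Graph n → ListAssignment n → ℕ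
col G L = length (filterᵇ (properᵇ G) (choices L))

colAt : ∀ {n} → Graph n → ListAssignment n → Fin n → ℕ → ℕ
colAt G L v c = length (filterᵇ (λ γ → properᵇ G γ ∧ (lookup γ v ≡ᵇ c)) (choices L))

-- G = G₁ ∪ G₂ + v₁v₂ on the vertex set Fin (n₁ + n₂), where the first n₁
-- vertices are those of G₁ (embedded by _↑ˡ n₂) and the rest those of G₂
-- (embedded by n₁ ↑ʳ_).
joinEdge : ∀ {n₁ n₂} → Graph n₁ → Graph n₂ → Fin n₁ → Fin n₂ → Graph (n₁ + n₂)
joinEdge {n₁} G₁ G₂ v₁ v₂ i j with splitAt n₁ i | splitAt n₁ j
... | inj₁ a | inj₁ b = G₁ a b
... | inj₂ a | inj₂ b = G₂ a b
... | inj₁ a | inj₂ b = ⌊ a ≟F v₁ ⌋ ∧ ⌊ b ≟F v₂ ⌋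
... | inj₂ a | inj₁ b = ⌊ b ≟F v₁ ⌋ ∧ ⌊ a ≟F v₂ ⌋

restrict₁ : ∀ {n₁ n₂} → ListAssignment (n₁ + n₂) → ListAssignment n₁
restrict₁ {n₁} {n₂} L v = L (v ↑ˡ n₂)

restrict₂ : ∀ {n₁ n₂} → ListAssignment (n₁ + n₂) → ListAssignment n₂
restrict₂ {n₁} {n₂} L v = L (n₁ ↑ʳ v)

-- Fix c₁ ∈ L(v₁) ∖ L(v₂) and c₂ ∈ L(v₂) ∖ L(v₁) and exchange c₁ and c₂ in every list of G₂.
-- List sizes are kept, and the colourings from the new lists are exactly the images of the old
-- ones under the same exchange on the G₂ side.  A colour shared by L(v₁) and L(v₂) is neither
-- c₁ nor c₂, so it is fixed; as v₁v₂ is the only edge between G₁ and G₂, the image of an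
-- improper colouring is improper, and the number of colourings cannot grow.  Each exchange
-- removes c₁ from L(v₁) ∖ L(v₂), so repeating it ends with nested lists at v₁ and v₂.
-- If c₁ and c₂ extend to colourings γ₁ of G₁ and γ₂ of G₂, the first exchange maps the proper
-- colouring γ₁ ∪ γ₂ of G to one that colours both v₁ and v₂ with c₁, so the count drops.

module Submission where

open import Defs
open import Data.Bool using (Bool; true; false; _∨_; not; T)
open import Data.Bool.ListAction using (all)
open import Data.Bool.Properties using (T-∧)
open import Data.Empty using (⊥-elim)
open import Data.Fin using (Fin; zero; suc; splitAt; _↑ˡ_; _↑ʳ_)
open import Data.Fin.Properties using (splitAt-↑ˡ; splitAt-↑ʳ; splitAt⁻¹-↑ˡ; splitAt⁻¹-↑ʳ)
  renaming (_≟_ to _≟ᶠ_)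
open import Data.List using (List; []; _∷_; length; map; filter; filterᵇ; concatMap; allFin)
open import Data.List.Membership.Propositional using (_∈_; _∉_; find; lose)
open import Data.List.Membership.Propositional.Properties
  using (∈-map⁺; ∈-map⁻; ∈-concatMap⁺; ∈-concatMap⁻; ∈-allFin)
open import Data.List.Properties using (map-∘; concatMap-map; concatMap-cong; map-concatMap; length-map)
open import Data.List.Relation.Binary.Subset.Propositional using (_⊆_)
import Data.List.Relation.Unary.All as All
open import Data.List.Relation.Unary.All.Properties using (all⁺; all⁻)
open import Data.List.Relation.Unary.Any using (Any; here; there; any?)
import Data.List.Relation.Unary.Unique.Propositional.Properties as Unique
open import Data.Nat using (ℕ; zero; suc; _+_; _≤_; _<_; s≤s; z≤n; _≡ᵇ_)
open import Data.Nat.Induction using (<-wellFounded)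
open import Data.Nat.Properties
  using (_≟_; ≡ᵇ⇒≡; ≡⇒≡ᵇ; ≤-refl; ≤-trans; ≤-<-trans; m≤n⇒m≤1+n; m<n⇒m<1+n)
  renaming (module ≤-Reasoning to ≤-R)
open import Data.List.Membership.DecPropositional _≟_ using (_∈?_; _∉?_)
open import Data.Product using (Σ; ∃; ∃₂; _×_; _,_)
open import Data.Sum using (_⊎_; inj₁; inj₂; [_,_]′)
open import Data.Vec using (Vec; []; _∷_; lookup; tabulate; _++_)
open import Data.Vec.Properties using (lookup∘tabulate; lookup-++ˡ; lookup-++ʳ)
open import Function using (_∘_; id; const; Equivalence)
open import Induction.WellFounded using (module All)
open import Level using (0ℓ)
import Relation.Binary.Construct.On as On
open import Relation.Binary.PropositionalEquality
  using (_≡_; _≢_; refl; sym; trans; cong; subst; module ≡-Reasoning)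
open import Relation.Nullary using (¬_; yes; no; ¬?; contradiction)
open import Relation.Nullary.Decidable using (⌊_⌋; _×-dec_; decidable-stable; fromWitness)
open import Relation.Unary using (Pred; Decidable)

module _ {A B : Set} {P : Pred B 0ℓ} {Q : Pred A 0ℓ} (P? : Decidable P) (Q? : Decidable Q) (f : A → B) where

  length-filter-map-≤ : ∀ xs → (∀ {x} → x ∈ xs → P (f x) → Q x) →
    length (filter P? (map f xs)) ≤ length (filter Q? xs)
  length-filter-map-≤ [] _ = z≤n
  length-filter-map-≤ (x ∷ xs) P⇒Q with P? (f x) | Q? x
  ... | yes _   | yes _  = s≤s (length-filter-map-≤ xs (P⇒Q ∘ there))
  ... | yes pfx | no ¬qx = contradiction (P⇒Q (here refl) pfx) ¬qx
  ... | no _    | yes _  = m≤n⇒m≤1+n (length-filter-map-≤ xs (P⇒Q ∘ there))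
  ... | no _    | no _   = length-filter-map-≤ xs (P⇒Q ∘ there)

  length-filter-map-< : ∀ {x₀} xs → (∀ {x} → x ∈ xs → P (f x) → Q x) →
    x₀ ∈ xs → Q x₀ → ¬ P (f x₀) → length (filter P? (map f xs)) < length (filter Q? xs)
  length-filter-map-< (x ∷ xs) P⇒Q (here refl) qx ¬pfx with P? (f x) | Q? x
  ... | yes pfx | _      = contradiction pfx ¬pfx
  ... | no _    | no ¬qx = contradiction qx ¬qx
  ... | no _    | yes _  = s≤s (length-filter-map-≤ xs (P⇒Q ∘ there))
  length-filter-map-< (x ∷ xs) P⇒Q (there x₀∈xs) qx₀ ¬pfx₀ with P? (f x) | Q? x
  ... | yes _   | yes _  = s≤s (length-filter-map-< xs (P⇒Q ∘ there) x₀∈xs qx₀ ¬pfx₀)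
  ... | yes pfx | no ¬qx = contradiction (P⇒Q (here refl) pfx) ¬qx
  ... | no _    | yes _  = m<n⇒m<1+n (length-filter-map-< xs (P⇒Q ∘ there) x₀∈xs qx₀ ¬pfx₀)
  ... | no _    | no _   = length-filter-map-< xs (P⇒Q ∘ there) x₀∈xs qx₀ ¬pfx₀

length-filter≢0⇒∃ : ∀ {A : Set} {P : Pred A 0ℓ} (P? : Decidable P) xs →
  length (filter P? xs) ≢ 0 → ∃ λ x → x ∈ xs × P x
length-filter≢0⇒∃ P? [] len≢0 = contradiction refl len≢0
length-filter≢0⇒∃ P? (x ∷ xs) len≢0 with P? x
... | yes px = x , here refl , px
... | no _   = let y , y∈xs , py = length-filter≢0⇒∃ P? xs len≢0 in y , there y∈xs , py

Proper : ∀ {n} → Graph n → Vec ℕ n → Set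
Proper {n} G γ = ∀ (i j : Fin n) → T (G i j) → lookup γ i ≢ lookup γ j

noConflictᵇ⇒ : ∀ b m n → T (not b ∨ not (m ≡ᵇ n)) → T b → m ≢ n
noConflictᵇ⇒ true m n noConflict _ m≡n with m ≡ᵇ n in eq
noConflictᵇ⇒ true m n () _ m≡n | true
... | false = subst T eq (≡⇒≡ᵇ m n m≡n)

noConflictᵇ⇐ : ∀ b m n → (T b → m ≢ n) → T (not b ∨ not (m ≡ᵇ n))
noConflictᵇ⇐ false m n _ = _
noConflictᵇ⇐ true m n m≢n with m ≡ᵇ n in eq
... | true  = m≢n _ (≡ᵇ⇒≡ m n (subst T (sym eq) _))
... | false = _

module _ {n} (G : Graph n) (γ : Vec ℕ n) where

  private
    noConflictᵇ : Fin n → Fin n → Bool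
    noConflictᵇ i j = not (G i j) ∨ not (lookup γ i ≡ᵇ lookup γ j)

    noConflictsAtᵇ : Fin n → Bool
    noConflictsAtᵇ i = all (noConflictᵇ i) (allFin n)

  properᵇ⇒Proper : T (properᵇ G γ) → Proper G γ
  properᵇ⇒Proper proper i j =
    noConflictᵇ⇒ (G i j) _ _ (All.lookup (all⁺ (noConflictᵇ i) (allFin n) atᵇ) (∈-allFin j))
    where
    atᵇ : T (noConflictsAtᵇ i)
    atᵇ = All.lookup (all⁺ noConflictsAtᵇ (allFin n) proper) (∈-allFin i)

  Proper⇒properᵇ : Proper G γ → T (properᵇ G γ)
  Proper⇒properᵇ proper = all⁻ noConflictsAtᵇ {xs = allFin n} (All.tabulate λ {i} _ →
    all⁻ (noConflictᵇ i) {xs = allFin n} (All.tabulate λ {j} _ → noConflictᵇ⇐ (G i j) _ _ (proper i j)))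

colAt≢0⇒colouring : ∀ {n} (G : Graph n) L v c → colAt G L v c ≢ 0 →
  ∃ λ γ → γ ∈ choices L × Proper G γ × lookup γ v ≡ c
colAt≢0⇒colouring G L v c nz =
  let γ , γ∈ , ok = length-filter≢0⇒∃ _ (choices L) nz
      proper , at-v = Equivalence.to T-∧ ok
  in γ , γ∈ , properᵇ⇒Proper G γ proper , ≡ᵇ⇒≡ _ _ at-v

∈-choices⁻ : ∀ {n} (L : ListAssignment n) {γ} → γ ∈ choices L → ∀ i → lookup γ i ∈ L i
∈-choices⁻ {suc n} L γ∈ i with find (∈-concatMap⁻ _ {xs = L zero} γ∈)
... | c , c∈ , γ∈′ with ∈-map⁻ (c ∷_) γ∈′
... | γ′ , γ′∈ , refl with i
... | zero  = c∈
... | suc i = ∈-choices⁻ (L ∘ suc) γ′∈ i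

∈-choices⁺ : ∀ {n} (L : ListAssignment n) {γ} → (∀ i → lookup γ i ∈ L i) → γ ∈ choices L
∈-choices⁺ {zero}  L {[]}    _     = here refl
∈-choices⁺ {suc n} L {c ∷ γ} γ∈L =
  ∈-concatMap⁺ _ (lose (γ∈L zero) (∈-map⁺ (c ∷_) (∈-choices⁺ (L ∘ suc) (γ∈L ∘ suc))))

recolour : ∀ {n} → (Fin n → ℕ → ℕ) → Vec ℕ n → Vec ℕ n
recolour h γ = tabulate λ i → h i (lookup γ i)

recolourLists : ∀ {n} → (Fin n → ℕ → ℕ) → ListAssignment n → ListAssignment n
recolourLists h L v = map (h v) (L v)

choices-recolourLists : ∀ {n} (h : Fin n → ℕ → ℕ) (L : ListAssignment n) →
  choices (recolourLists h L) ≡ map (recolour h) (choices L)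
choices-recolourLists {zero}  h L = refl
choices-recolourLists {suc n} h L = begin
  concatMap (λ c → map (c ∷_) (choices (recolourLists (h ∘ suc) (L ∘ suc)))) (map (h zero) (L zero))
    ≡⟨ cong (λ γs → concatMap (λ c → map (c ∷_) γs) (map (h zero) (L zero)))
            (choices-recolourLists (h ∘ suc) (L ∘ suc)) ⟩
  concatMap (λ c → map (c ∷_) (map (recolour (h ∘ suc)) γs)) (map (h zero) (L zero))
    ≡⟨ concatMap-map _ (h zero) (L zero) ⟩
  concatMap (λ c → map (h zero c ∷_) (map (recolour (h ∘ suc)) γs)) (L zero)
    ≡⟨ concatMap-cong (λ c → trans (sym (map-∘ γs)) (map-∘ γs)) (L zero) ⟩
  concatMap (λ c → map (recolour h) (map (c ∷_) γs)) (L zero)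
    ≡⟨ sym (map-concatMap (recolour h) _ (L zero)) ⟩
  map (recolour h) (concatMap (λ c → map (c ∷_) γs) (L zero)) ∎
  where
  open ≡-Reasoning
  γs = choices (L ∘ suc)

PreservesConflicts : ∀ {n} → Graph n → ListAssignment n → (Fin n → ℕ → ℕ) → Set
PreservesConflicts {n} G L h = ∀ {γ} → γ ∈ choices L → ∀ (i j : Fin n) → T (G i j) →
  lookup γ i ≡ lookup γ j → h i (lookup γ i) ≡ h j (lookup γ j)

module _ {n} (G : Graph n) (L : ListAssignment n) (h : Fin n → ℕ → ℕ) (preserves : PreservesConflicts G L h) where

  private
    properᵇ-recolour⇒properᵇ : ∀ {γ} → γ ∈ choices L → T (properᵇ G (recolour h γ)) → T (properᵇ G γ)
    properᵇ-recolour⇒properᵇ {γ} γ∈ proper′ = Proper⇒properᵇ G γ λ i j eij γi≡γj →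
      properᵇ⇒Proper G (recolour h γ) proper′ i j eij (begin
        lookup (recolour h γ) i  ≡⟨ lookup∘tabulate _ i ⟩
        h i (lookup γ i)         ≡⟨ preserves γ∈ i j eij γi≡γj ⟩
        h j (lookup γ j)         ≡⟨ lookup∘tabulate _ j ⟨
        lookup (recolour h γ) j  ∎)
      where open ≡-Reasoning

    col-recolourLists :
      col G (recolourLists h L) ≡ length (filterᵇ (properᵇ G) (map (recolour h) (choices L)))
    col-recolourLists = cong (length ∘ filterᵇ (properᵇ G)) (choices-recolourLists h L)

  col-recolourLists-≤ : col G (recolourLists h L) ≤ col G L
  col-recolourLists-≤ = begin
    col G (recolourLists h L)  ≡⟨ col-recolourLists ⟩
    length (filterᵇ (properᵇ G) (map (recolour h) (choices L)))
      ≤⟨ length-filter-map-≤ _ _ _ (choices L) properᵇ-recolour⇒properᵇ ⟩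
    col G L                    ∎
    where open ≤-R

  col-recolourLists-< : ∀ {γ} → γ ∈ choices L → Proper G γ → ¬ Proper G (recolour h γ) →
    col G (recolourLists h L) < col G L
  col-recolourLists-< {γ} γ∈ proper improper′ = begin-strict
    col G (recolourLists h L)  ≡⟨ col-recolourLists ⟩
    length (filterᵇ (properᵇ G) (map (recolour h) (choices L)))
      <⟨ length-filter-map-< _ _ _ (choices L) properᵇ-recolour⇒properᵇ
           γ∈ (Proper⇒properᵇ G γ proper) (improper′ ∘ properᵇ⇒Proper G (recolour h γ)) ⟩
    col G L                    ∎
    where open ≤-R

¬Any∉⇒⊆ : {xs ys : List ℕ} → ¬ Any (_∉ ys) xs → xs ⊆ ys
¬Any∉⇒⊆ {ys = ys} ∄x∉ys {x} x∈xs = decidable-stable (x ∈? ys) (∄x∉ys ∘ lose x∈xs)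

transpose : ℕ → ℕ → ℕ → ℕ
transpose a b x with x ≟ a
... | yes _ = b
... | no _ with x ≟ b
...   | yes _ = a
...   | no _  = x

transpose-fixes : ∀ {a b x} → x ≢ a → x ≢ b → transpose a b x ≡ x
transpose-fixes {a} {b} {x} x≢a x≢b with x ≟ a
... | yes x≡a = contradiction x≡a x≢a
... | no _ with x ≟ b
...   | yes x≡b = contradiction x≡b x≢b
...   | no _    = refl

transpose-first : ∀ a b → transpose a b a ≡ b
transpose-first a b with a ≟ a
... | yes _   = refl
... | no a≢a = contradiction refl a≢a

transpose-second : ∀ a b → transpose a b b ≡ a
transpose-second a b with b ≟ a
... | yes b≡a = b≡a
... | no _ with b ≟ b
...   | yes _   = refl
...   | no b≢b = contradiction refl b≢b

transpose-involutive : ∀ a b x → transpose a b (transpose a b x) ≡ x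
transpose-involutive a b x with x ≟ a
... | yes refl = transpose-second x b
... | no x≢a with x ≟ b
...   | yes refl = transpose-first a x
...   | no x≢b   = transpose-fixes x≢a x≢b

transpose-injective : ∀ a b {x y} → transpose a b x ≡ transpose a b y → x ≡ y
transpose-injective a b {x} {y} eq = begin
  x                                  ≡⟨ transpose-involutive a b x ⟨
  transpose a b (transpose a b x)    ≡⟨ cong (transpose a b) eq ⟩
  transpose a b (transpose a b y)    ≡⟨ transpose-involutive a b y ⟩
  y                                  ∎
  where open ≡-Reasoning

data Side (n₁ n₂ : ℕ) : Fin (n₁ + n₂) → Set where
  left  : ∀ a → Side n₁ n₂ (a ↑ˡ n₂)
  right : ∀ b → Side n₁ n₂ (n₁ ↑ʳ b)

side : ∀ {n₁ n₂} (i : Fin (n₁ + n₂)) → Side n₁ n₂ i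
side {n₁} {n₂} i with splitAt n₁ i in eq
... | inj₁ a = subst (Side n₁ n₂) (splitAt⁻¹-↑ˡ eq) (left a)
... | inj₂ b = subst (Side n₁ n₂) (splitAt⁻¹-↑ʳ eq) (right b)

module Join {n₁ n₂} (G₁ : Graph n₁) (G₂ : Graph n₂) (v₁ : Fin n₁) (v₂ : Fin n₂) where

  G : Graph (n₁ + n₂)
  G = joinEdge G₁ G₂ v₁ v₂

  p₁ p₂ : Fin (n₁ + n₂)
  p₁ = v₁ ↑ˡ n₂
  p₂ = n₁ ↑ʳ v₂

  data Edge : Fin (n₁ + n₂) → Fin (n₁ + n₂) → Set where
    edge₁   : ∀ {a b} → T (G₁ a b) → Edge (a ↑ˡ n₂) (b ↑ˡ n₂)
    edge₂   : ∀ {a b} → T (G₂ a b) → Edge (n₁ ↑ʳ a) (n₁ ↑ʳ b)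
    bridge  : Edge p₁ p₂
    bridge˘ : Edge p₂ p₁

  edge : ∀ {i j} → T (G i j) → Edge i j
  edge {i} {j} eij with side {n₁} {n₂} i | side {n₁} {n₂} j
  ... | left a  | left b  rewrite splitAt-↑ˡ n₁ a n₂ | splitAt-↑ˡ n₁ b n₂ = edge₁ eij
  ... | right a | right b rewrite splitAt-↑ʳ n₁ n₂ a | splitAt-↑ʳ n₁ n₂ b = edge₂ eij
  ... | left a  | right b rewrite splitAt-↑ˡ n₁ a n₂ | splitAt-↑ʳ n₁ n₂ b with a ≟ᶠ v₁ | b ≟ᶠ v₂
  ...   | yes refl | yes refl = bridge
  ...   | no _     | _        = ⊥-elim eij
  ...   | yes _    | no _     = ⊥-elim eij
  edge {i} {j} eij | right a | left b rewrite splitAt-↑ʳ n₁ n₂ a | splitAt-↑ˡ n₁ b n₂ with b ≟ᶠ v₁ | a ≟ᶠ v₂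
  ...   | yes refl | yes refl = bridge˘
  ...   | no _     | _        = ⊥-elim eij
  ...   | yes _    | no _     = ⊥-elim eij

  G-bridge : T (G p₁ p₂)
  G-bridge rewrite splitAt-↑ˡ n₁ v₁ n₂ | splitAt-↑ʳ n₁ n₂ v₂ =
    Equivalence.from (T-∧ {⌊ v₁ ≟ᶠ v₁ ⌋}) (fromWitness {a? = v₁ ≟ᶠ v₁} refl , fromWitness {a? = v₂ ≟ᶠ v₂} refl)

  Proper-++ : ∀ {γ₁ γ₂} → Proper G₁ γ₁ → Proper G₂ γ₂ → lookup γ₁ v₁ ≢ lookup γ₂ v₂ →
    Proper G (γ₁ ++ γ₂)
  Proper-++ {γ₁} {γ₂} proper₁ proper₂ γ₁v₁≢γ₂v₂ i j eij = distinct (edge eij)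
    where
    ˡ = lookup-++ˡ γ₁ γ₂
    ʳ = lookup-++ʳ γ₁ γ₂

    distinct : ∀ {i j} → Edge i j → lookup (γ₁ ++ γ₂) i ≢ lookup (γ₁ ++ γ₂) j
    distinct (edge₁ {a} {b} eab) eq = proper₁ a b eab (trans (sym (ˡ a)) (trans eq (ˡ b)))
    distinct (edge₂ {a} {b} eab) eq = proper₂ a b eab (trans (sym (ʳ a)) (trans eq (ʳ b)))
    distinct bridge              eq = γ₁v₁≢γ₂v₂ (trans (sym (ˡ v₁)) (trans eq (ʳ v₂)))
    distinct bridge˘             eq = γ₁v₁≢γ₂v₂ (trans (sym (ˡ v₁)) (trans (sym eq) (ʳ v₂)))

  ∈-choices-++ : ∀ (L : ListAssignment (n₁ + n₂)) {γ₁ γ₂} →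
    γ₁ ∈ choices (restrict₁ {n₁} {n₂} L) → γ₂ ∈ choices (restrict₂ {n₁} {n₂} L) → γ₁ ++ γ₂ ∈ choices L
  ∈-choices-++ L {γ₁} {γ₂} γ₁∈ γ₂∈ = ∈-choices⁺ L λ i → lookup-++∈L i (side {n₁} {n₂} i)
    where
    lookup-++∈L : ∀ i → Side n₁ n₂ i → lookup (γ₁ ++ γ₂) i ∈ L i
    lookup-++∈L _ (left a)  = subst (_∈ L (a ↑ˡ n₂)) (sym (lookup-++ˡ γ₁ γ₂ a)) (∈-choices⁻ _ γ₁∈ a)
    lookup-++∈L _ (right b) = subst (_∈ L (n₁ ↑ʳ b)) (sym (lookup-++ʳ γ₁ γ₂ b)) (∈-choices⁻ _ γ₂∈ b)

  swapRight : ℕ → ℕ → Fin (n₁ + n₂) → ℕ → ℕ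
  swapRight c₁ c₂ i = [ const id , const (transpose c₁ c₂) ]′ (splitAt n₁ i)

  swapRight-↑ˡ : ∀ c₁ c₂ a x → swapRight c₁ c₂ (a ↑ˡ n₂) x ≡ x
  swapRight-↑ˡ c₁ c₂ a x rewrite splitAt-↑ˡ n₁ a n₂ = refl

  swapRight-↑ʳ : ∀ c₁ c₂ b x → swapRight c₁ c₂ (n₁ ↑ʳ b) x ≡ transpose c₁ c₂ x
  swapRight-↑ʳ c₁ c₂ b x rewrite splitAt-↑ʳ n₁ n₂ b = refl

  swapRight-injective : ∀ c₁ c₂ i {x y} → swapRight c₁ c₂ i x ≡ swapRight c₁ c₂ i y → x ≡ y
  swapRight-injective c₁ c₂ i with splitAt n₁ i
  ... | inj₁ _ = id
  ... | inj₂ _ = transpose-injective c₁ c₂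

  swapped : ListAssignment (n₁ + n₂) → ℕ → ℕ → ListAssignment (n₁ + n₂)
  swapped L c₁ c₂ = recolourLists (swapRight c₁ c₂) L

  unshared : ListAssignment (n₁ + n₂) → ℕ
  unshared L = length (filter (_∉? L p₂) (L p₁))

  record Reduction (L L′ : ListAssignment (n₁ + n₂)) : Set where
    constructor reduction
    field
      isListAssignment : IsListAssignment L′
      sameLengths      : ∀ v → length (L′ v) ≡ length (L v)
      col≤             : col G L′ ≤ col G L

  reduction-refl : ∀ {L} → IsListAssignment L → Reduction L L
  reduction-refl uL = reduction uL (λ _ → refl) ≤-refl

  reduction-trans : ∀ {L L₀ L′} → Reduction L L₀ → Reduction L₀ L′ → Reduction L L′
  reduction-trans (reduction _ len₀ le₀) (reduction uL′ len′ le′) =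
    reduction uL′ (λ v → trans (len′ v) (len₀ v)) (≤-trans le′ le₀)

  module Swap (L : ListAssignment (n₁ + n₂)) {c₁ c₂ : ℕ} (c₁∉ : c₁ ∉ L p₂) (c₂∉ : c₂ ∉ L p₁) where

    private
      h : Fin (n₁ + n₂) → ℕ → ℕ
      h = swapRight c₁ c₂

    swapRight-fixes-shared : ∀ i {x} → x ∈ L p₁ → x ∈ L p₂ → h i x ≡ x
    swapRight-fixes-shared i x∈₁ x∈₂ with splitAt n₁ i
    ... | inj₁ _ = refl
    ... | inj₂ _ = transpose-fixes (λ { refl → c₁∉ x∈₂ }) (λ { refl → c₂∉ x∈₁ })

    bridge-preservesConflict : ∀ {γ} → γ ∈ choices L → lookup γ p₁ ≡ lookup γ p₂ →
      h p₁ (lookup γ p₁) ≡ h p₂ (lookup γ p₂)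
    bridge-preservesConflict {γ} γ∈ γp₁≡γp₂ = begin
      h p₁ (lookup γ p₁)  ≡⟨ swapRight-fixes-shared p₁ γp₁∈L₁ (subst (_∈ L p₂) (sym γp₁≡γp₂) γp₂∈L₂) ⟩
      lookup γ p₁         ≡⟨ γp₁≡γp₂ ⟩
      lookup γ p₂         ≡⟨ swapRight-fixes-shared p₂ (subst (_∈ L p₁) γp₁≡γp₂ γp₁∈L₁) γp₂∈L₂ ⟨
      h p₂ (lookup γ p₂)  ∎
      where
      open ≡-Reasoning
      γp₁∈L₁ = ∈-choices⁻ L γ∈ p₁
      γp₂∈L₂ = ∈-choices⁻ L γ∈ p₂

    swapRight-preservesConflicts : PreservesConflicts G L h
    swapRight-preservesConflicts γ∈ i j eij γi≡γj with edge eij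
    ... | edge₁ {a} {b} _ = trans (swapRight-↑ˡ c₁ c₂ a _) (trans γi≡γj (sym (swapRight-↑ˡ c₁ c₂ b _)))
    ... | edge₂ {a} {b} _ =
      trans (swapRight-↑ʳ c₁ c₂ a _) (trans (cong (transpose c₁ c₂) γi≡γj) (sym (swapRight-↑ʳ c₁ c₂ b _)))
    ... | bridge  = bridge-preservesConflict γ∈ γi≡γj
    ... | bridge˘ = sym (bridge-preservesConflict γ∈ (sym γi≡γj))

    swap-reduction : IsListAssignment L → Reduction L (swapped L c₁ c₂)
    swap-reduction uL = reduction
      (λ v → Unique.map⁺ (swapRight-injective c₁ c₂ v) (uL v))
      (λ v → length-map (h v) (L v))
      (col-recolourLists-≤ G L h swapRight-preservesConflicts)

    swapRight-c₂ : h p₂ c₂ ≡ h p₁ c₁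
    swapRight-c₂ = begin
      h p₂ c₂               ≡⟨ swapRight-↑ʳ c₁ c₂ v₂ c₂ ⟩
      transpose c₁ c₂ c₂    ≡⟨ transpose-second c₁ c₂ ⟩
      c₁                    ≡⟨ swapRight-↑ˡ c₁ c₂ v₁ c₁ ⟨
      h p₁ c₁               ∎
      where open ≡-Reasoning

    unshared-swapped-< : c₁ ∈ L p₁ → c₂ ∈ L p₂ → unshared (swapped L c₁ c₂) < unshared L
    unshared-swapped-< c₁∈ c₂∈ = length-filter-map-< (_∉? map (h p₂) (L p₂)) (_∉? L p₂) (h p₁) (L p₁)
      stays-unshared c₁∈ c₁∉ (λ hc₁∉ → hc₁∉ (subst (_∈ map (h p₂) (L p₂)) swapRight-c₂ (∈-map⁺ (h p₂) c₂∈)))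
      where
      stays-unshared : ∀ {x} → x ∈ L p₁ → h p₁ x ∉ map (h p₂) (L p₂) → x ∉ L p₂
      stays-unshared x∈₁ hx∉ x∈₂ = hx∉ (subst (_∈ map (h p₂) (L p₂))
        (trans (swapRight-fixes-shared p₂ x∈₁ x∈₂) (sym (swapRight-fixes-shared p₁ x∈₁ x∈₂))) (∈-map⁺ (h p₂) x∈₂))

    col-swapped-< : colAt G₁ (restrict₁ {n₁} {n₂} L) v₁ c₁ ≢ 0 →
      colAt G₂ (restrict₂ {n₁} {n₂} L) v₂ c₂ ≢ 0 →
      col G (swapped L c₁ c₂) < col G L
    col-swapped-< nz₁ nz₂
      with colAt≢0⇒colouring G₁ _ v₁ c₁ nz₁ | colAt≢0⇒colouring G₂ _ v₂ c₂ nz₂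
    ... | γ₁ , γ₁∈ , proper₁ , γ₁v₁≡c₁ | γ₂ , γ₂∈ , proper₂ , γ₂v₂≡c₂ =
      col-recolourLists-< G L h swapRight-preservesConflicts
        (∈-choices-++ L γ₁∈ γ₂∈) (Proper-++ {γ₁} {γ₂} proper₁ proper₂ γ₁v₁≢γ₂v₂) recoloured-improper
      where
      open ≡-Reasoning
      γ = γ₁ ++ γ₂

      γ₁v₁≢γ₂v₂ : lookup γ₁ v₁ ≢ lookup γ₂ v₂
      γ₁v₁≢γ₂v₂ eq = c₁∉ (subst (_∈ L p₂) (trans (sym eq) γ₁v₁≡c₁) (∈-choices⁻ _ γ₂∈ v₂))

      recoloured-improper : ¬ Proper G (recolour h γ)
      recoloured-improper proper = proper p₁ p₂ G-bridge (begin
        lookup (recolour h γ) p₁   ≡⟨ lookup∘tabulate _ p₁ ⟩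
        h p₁ (lookup γ p₁)         ≡⟨ cong (h p₁) (trans (lookup-++ˡ γ₁ γ₂ v₁) γ₁v₁≡c₁) ⟩
        h p₁ c₁                    ≡⟨ swapRight-c₂ ⟨
        h p₂ c₂                    ≡⟨ cong (h p₂) (trans (lookup-++ʳ γ₁ γ₂ v₂) γ₂v₂≡c₂) ⟨
        h p₂ (lookup γ p₂)         ≡⟨ lookup∘tabulate _ p₂ ⟨
        lookup (recolour h γ) p₂   ∎)

  Nested : ListAssignment (n₁ + n₂) → Set
  Nested L = L p₁ ⊆ L p₂ ⊎ L p₂ ⊆ L p₁

  NestedReduction : ListAssignment (n₁ + n₂) → Set
  NestedReduction L = ∃ λ L′ → Reduction L L′ × Nested L′

  nest : ∀ L → IsListAssignment L → NestedReduction L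
  nest = All.wfRec (On.wellFounded unshared <-wellFounded) 0ℓ _ step
    where
    step : ∀ L → (∀ {L₀} → unshared L₀ < unshared L → IsListAssignment L₀ → NestedReduction L₀) →
      IsListAssignment L → NestedReduction L
    step L nest< uL with any? (_∉? L p₂) (L p₁) | any? (_∉? L p₁) (L p₂)
    ... | no ∄c₁  | _       = L , reduction-refl uL , inj₁ (¬Any∉⇒⊆ ∄c₁)
    ... | yes _   | no ∄c₂  = L , reduction-refl uL , inj₂ (¬Any∉⇒⊆ ∄c₂)
    ... | yes ∃c₁ | yes ∃c₂ =
      let c₁ , c₁∈ , c₁∉ = find ∃c₁
          c₂ , c₂∈ , c₂∉ = find ∃c₂
          open Swap L c₁∉ c₂∉
          L′ , L₀→L′ , nested =
            nest< (unshared-swapped-< c₁∈ c₂∈) (Reduction.isListAssignment (swap-reduction uL))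
      in L′ , reduction-trans (swap-reduction uL) L₀→L′ , nested

  StrictnessWitness : ListAssignment (n₁ + n₂) → Set
  StrictnessWitness L = ∃₂ λ (c₁ c₂ : ℕ) →
    c₁ ∈ L p₁ × c₁ ∉ L p₂ × c₂ ∈ L p₂ × c₂ ∉ L p₁ ×
    colAt G₁ (restrict₁ {n₁} {n₂} L) v₁ c₁ ≢ 0 × colAt G₂ (restrict₂ {n₁} {n₂} L) v₂ c₂ ≢ 0

  firstSwap : ∀ L → IsListAssignment L →
    ∃ λ L₀ → Reduction L L₀ × (StrictnessWitness L → col G L₀ < col G L)
  firstSwap L uL
    with any? (λ c → c ∉? L p₂ ×-dec ¬? (colAt G₁ (restrict₁ {n₁} {n₂} L) v₁ c ≟ 0)) (L p₁)
       | any? (λ c → c ∉? L p₁ ×-dec ¬? (colAt G₂ (restrict₂ {n₁} {n₂} L) v₂ c ≟ 0)) (L p₂)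
  ... | yes ∃c₁ | yes ∃c₂ =
    let c₁ , _ , c₁∉ , nz₁ = find ∃c₁
        c₂ , _ , c₂∉ , nz₂ = find ∃c₂
        open Swap L c₁∉ c₂∉
    in swapped L c₁ c₂ , swap-reduction uL , λ _ → col-swapped-< nz₁ nz₂
  ... | no ∄c₁ | _ = L , reduction-refl uL ,
    λ (c₁ , _ , c₁∈ , c₁∉ , _ , _ , nz₁ , _) → contradiction (lose c₁∈ (c₁∉ , nz₁)) ∄c₁
  ... | yes _ | no ∄c₂ = L , reduction-refl uL ,
    λ (_ , c₂ , _ , _ , c₂∈ , c₂∉ , _ , nz₂) → contradiction (lose c₂∈ (c₂∉ , nz₂)) ∄c₂

mainTheorem2 : ∀ {n₁ n₂} (G₁ : Graph n₁) (G₂ : Graph n₂) → IsSimple G₁ → IsSimple G₂ →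
    (v₁ : Fin n₁) (v₂ : Fin n₂) (L : ListAssignment (n₁ + n₂)) → IsListAssignment L →
    Σ (ListAssignment (n₁ + n₂)) (λ L′ →
      IsListAssignment L′ ×
      (∀ v → length (L′ v) ≡ length (L v)) ×
      (L′ (v₁ ↑ˡ n₂) ⊆ L′ (n₁ ↑ʳ v₂) ⊎ L′ (n₁ ↑ʳ v₂) ⊆ L′ (v₁ ↑ˡ n₂)) ×
      col (joinEdge G₁ G₂ v₁ v₂) L′ ≤ col (joinEdge G₁ G₂ v₁ v₂) L ×
      ((∃₂ λ (c₁ c₂ : ℕ) →
          c₁ ∈ L (v₁ ↑ˡ n₂) × c₁ ∉ L (n₁ ↑ʳ v₂) ×
          c₂ ∈ L (n₁ ↑ʳ v₂) × c₂ ∉ L (v₁ ↑ˡ n₂) ×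
          colAt G₁ (restrict₁ {n₁} {n₂} L) v₁ c₁ ≢ 0 ×
          colAt G₂ (restrict₂ {n₁} {n₂} L) v₂ c₂ ≢ 0) →
        col (joinEdge G₁ G₂ v₁ v₂) L′ < col (joinEdge G₁ G₂ v₁ v₂) L))
mainTheorem2 G₁ G₂ _ _ v₁ v₂ L uL =
  let L₀ , L→L₀ , strict = firstSwap L uL
      L′ , L₀→L′ , nested = nest L₀ (Reduction.isListAssignment L→L₀)
      open Reduction (reduction-trans L→L₀ L₀→L′)
  in L′ , isListAssignment , sameLengths , nested , col≤ ,
     λ witness → ≤-<-trans (Reduction.col≤ L₀→L′) (strict witness)
  where open Join G₁ G₂ v₁ v₂
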